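{- Let $f,g:\{0,1\}^n\to\{0,1\}$ and $h=f\oplus g$, and let $f^{\pm}=(-1)^f$, $g^{\pm}=(-1)^g$, $h^{\pm}=(-1)^h$. Then $|\mathrm{gran}(f^{\pm})-\mathrm{gran}(g^{\pm})|\le\mathrm{gran}(h^{\pm})\le\mathrm{gran}(f^{\pm})+\mathrm{gran}(g^{\pm})$.
   Context: For $u:\{0,1\}^n\to\mathbb{R}$, $\hat u(S)=2^{ -n}\sum_x u(x)(-1)^{\sum_{i\in S}x_i}$. A nonzero rational $r$ has granularity $\mathrm{gran}(r)=k$ if $r=m/2^k$ for some odd integer $m$; the Fourier granularity $\mathrm{gran}(u)$ of a function is the maximum of $\mathrm{gran}(\hat u(S))$ over all $S$ with $\hat u(S)\neq 0$. -}

module Defs where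

open import Data.Bool using (Bool; true; false; _∧_; _xor_; if_then_else_)
open import Data.Nat as ℕ using (ℕ; zero; suc)
open import Data.Integer as ℤ using (ℤ; +_; -[1+_]; +[1+_])
open import Data.Integer.Divisibility using () renaming (_∣_ to _∣ℤ_)
open import Data.Rational as ℚ using (ℚ; 0ℚ; 1ℚ; ½; _/_)
open import Data.Vec using (Vec; []; _∷_)
open import Data.List using (List; []; _∷_; map; _++_; foldr)
open import Data.Product using (Σ; _×_; ∃; ∃-syntax; _,_)
open import Relation.Binary.PropositionalEquality using (_≡_)
open import Relation.Nullary using (¬_)

-- The Boolean cube {0,1}^n : points are Vec Bool n (false = 0, true = 1).
Cube : ℕ → Set
Cube n = Vec Bool n

allPoints : (n : ℕ) → List (Cube n)
allPoints zero = [] ∷ []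
allPoints (suc n) = map (false ∷_) (allPoints n) ++ map (true ∷_) (allPoints n)

-- Subsets S ⊆ [n] are given by indicator vectors Vec Bool n.
-- parity S x = (Σ_{i ∈ S} x_i) mod 2.
parity : {n : ℕ} → Vec Bool n → Cube n → Bool
parity [] [] = false
parity (s ∷ S) (x ∷ xs) = (s ∧ x) xor parity S xs

sign : Bool → ℚ
sign false = 1ℚ
sign true = ℚ.- 1ℚ

sumℚ : List ℚ → ℚ
sumℚ = foldr ℚ._+_ 0ℚ

half^ : ℕ → ℚ
half^ zero = 1ℚ
half^ (suc n) = ½ ℚ.* half^ n

fourier : {n : ℕ} → (Cube n → ℚ) → Vec Bool n → ℚ
fourier {n} u S = half^ n ℚ.* sumℚ (map (λ x → u x ℚ.* sign (parity S x)) (allPoints n))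

two^ : ℤ → ℚ
two^ (+ k) = (+ (2 ℕ.^ k)) / 1
two^ -[1+ k ] = half^ (suc k)

Odd : ℤ → Set
Odd m = ¬ ((+ 2) ∣ℤ m)

-- gran(r) = k  iff  r = m / 2^k for some odd integer m
-- (for r = 0 no such k exists, so Gran 0 k never holds).
Gran : ℚ → ℤ → Set
Gran r k = ∃[ m ] (Odd m × r ≡ (m / 1) ℚ.* two^ (ℤ.- k))

FourierGran : {n : ℕ} → (Cube n → ℚ) → ℤ → Set
FourierGran {n} u k =
  (∃[ S ] (¬ fourier u S ≡ 0ℚ × Gran (fourier u S) k)) ×
  (∀ S j → ¬ fourier u S ≡ 0ℚ → Gran (fourier u S) j → j ℤ.≤ k)

pm : {n : ℕ} → (Cube n → Bool) → Cube n → ℚ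
pm f x = sign (f x)

module Submission where

-- Any one of the three ±1-valued functions is the product of the other two, so the
-- theorem reduces to a single inequality: if w = u · v with u, v integer valued, then
-- gran(w) ≤ gran(u) + gran(v).  Its three instances give c ≤ a + b, a ≤ c + b and
-- b ≤ c + a, which together say |a - b| ≤ c ≤ a + b.
--
-- The inequality is proved through the lattices αℤ ⊂ ℚ ("q is an integer multiple of α"):
--   * a rational of granularity k lies in 2^{-d}ℤ iff k ≤ d (via 2-adic factorisation);
--   * the Fourier coefficients of an integer-valued function on {0,1}^n lie in 2^{-n}ℤ,
--     so each nonzero one has a granularity, and Fourier granularity ≤ a means that all
--     coefficients lie in 2^{-a}ℤ;
--   * (product lemma) if all û(S) ∈ αℤ and all v̂(S) ∈ βℤ then all (uv)^(S) ∈ αβℤ.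
-- The product lemma is proved by induction on n: the coefficients of u at b ∷ S are those
-- of the function x ↦ ½ (u(0x) + (-1)^b u(1x)) at S, and this splitting is multiplicative.

open import Defs
open import Data.Bool using (Bool; true; false; _xor_; not; _∧_)
open import Data.Bool.Properties using (∧-zeroʳ; ∧-identityʳ; xor-assoc; xor-same; xor-identityʳ; xor-comm)
open import Data.Nat as ℕ using (ℕ; zero; suc)
import Data.Nat.Properties as ℕP
open import Data.Nat.Divisibility as ℕD using (divides; _∣?_)
open import Data.Nat.Induction using (<-wellFounded)
open import Induction.WellFounded using (Acc; acc)
open import Data.Integer as ℤ using (ℤ; +_; -[1+_]; _-_; _+_; _≤_; ∣_∣)
import Data.Integer.Properties as ℤP
import Data.Integer.Solver as ℤSolver
open import Data.Rational as ℚ using (ℚ; 0ℚ; 1ℚ; ½; _/_; toℚᵘ)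
import Data.Rational.Properties as ℚP
import Data.Rational.Unnormalised as U
import Data.Rational.Unnormalised.Properties as UP
open import Data.Rational.Solver using (module +-*-Solver)
open import Data.List using ([]; _∷_; map; _++_)
import Data.List.Properties as LP
open import Data.Vec using ([]; _∷_)
open import Data.Product using (Σ; _,_; _×_)
open import Data.Sum using (inj₁; inj₂)
open import Data.Empty using (⊥-elim)
open import Relation.Binary.PropositionalEquality
open import Relation.Nullary using (¬_; yes; no)

open +-*-Solver
module ℤS = ℤSolver.+-*-Solver

ι : ℤ → ℚ
ι z = z / 1

toℚᵘ-ι : ∀ z → toℚᵘ (ι z) U.≃ U.mkℚᵘ z 0
toℚᵘ-ι z = ℚP.toℚᵘ-fromℚᵘ (U.mkℚᵘ z 0)

ι-+ : ∀ x y → ι x ℚ.+ ι y ≡ ι (x ℤ.+ y)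
ι-+ x y = ℚP.toℚᵘ-injective (UP.≃-trans (ℚP.toℚᵘ-homo-+ (ι x) (ι y))
  (UP.≃-trans (UP.+-cong (toℚᵘ-ι x) (toℚᵘ-ι y))
  (UP.≃-trans (UP.≃-reflexive (cong₂ (λ a b → U.mkℚᵘ (a ℤ.+ b) 0) (ℤP.*-identityʳ x) (ℤP.*-identityʳ y)))
  (UP.≃-sym (toℚᵘ-ι (x ℤ.+ y))))))

ι-* : ∀ x y → ι x ℚ.* ι y ≡ ι (x ℤ.* y)
ι-* x y = ℚP.toℚᵘ-injective (UP.≃-trans (ℚP.toℚᵘ-homo-* (ι x) (ι y))
  (UP.≃-trans (UP.*-cong (toℚᵘ-ι x) (toℚᵘ-ι y)) (UP.≃-sym (toℚᵘ-ι (x ℤ.* y)))))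

ι-injective : ∀ x y → ι x ≡ ι y → x ≡ y
ι-injective x y eq with UP.≃-trans (UP.≃-sym (toℚᵘ-ι x)) (UP.≃-trans (ℚP.toℚᵘ-cong eq) (toℚᵘ-ι y))
... | U.*≡* e = trans (sym (ℤP.*-identityʳ x)) (trans e (ℤP.*-identityʳ y))

two^-suc : ∀ z → two^ (+ 1 ℤ.+ z) ≡ ι (+ 2) ℚ.* two^ z
two^-suc (+ k) = trans (cong ι (ℤP.pos-* 2 (2 ℕ.^ k))) (sym (ι-* (+ 2) (+ (2 ℕ.^ k))))
two^-suc -[1+ 0 ] = refl
two^-suc -[1+ suc k ] = sym (begin
  ι (+ 2) ℚ.* (½ ℚ.* half^ (suc k)) ≡⟨ sym (ℚP.*-assoc (ι (+ 2)) ½ (half^ (suc k))) ⟩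
  (ι (+ 2) ℚ.* ½) ℚ.* half^ (suc k) ≡⟨ ℚP.*-identityˡ (half^ (suc k)) ⟩
  half^ (suc k) ∎)
  where open ≡-Reasoning

two^-shift : ∀ d x → two^ (+ d ℤ.+ x) ≡ ι (+ (2 ℕ.^ d)) ℚ.* two^ x
two^-shift zero x = trans (cong two^ (ℤP.+-identityˡ x)) (sym (ℚP.*-identityˡ _))
two^-shift (suc d) x = begin
  two^ (+ suc d ℤ.+ x)                      ≡⟨ cong two^ (ℤP.+-assoc (+ 1) (+ d) x) ⟩
  two^ (+ 1 ℤ.+ (+ d ℤ.+ x))                ≡⟨ two^-suc (+ d ℤ.+ x) ⟩
  ι (+ 2) ℚ.* two^ (+ d ℤ.+ x)              ≡⟨ cong (ι (+ 2) ℚ.*_) (two^-shift d x) ⟩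
  ι (+ 2) ℚ.* (ι (+ (2 ℕ.^ d)) ℚ.* two^ x)  ≡⟨ sym (ℚP.*-assoc (ι (+ 2)) (ι (+ (2 ℕ.^ d))) (two^ x)) ⟩
  (ι (+ 2) ℚ.* ι (+ (2 ℕ.^ d))) ℚ.* two^ x  ≡⟨ cong (ℚ._* two^ x) (ι-* (+ 2) (+ (2 ℕ.^ d))) ⟩
  ι (+ 2 ℤ.* + (2 ℕ.^ d)) ℚ.* two^ x        ≡⟨ cong (λ t → ι t ℚ.* two^ x) (sym (ℤP.pos-* 2 (2 ℕ.^ d))) ⟩
  ι (+ (2 ℕ.^ suc d)) ℚ.* two^ x            ∎
  where open ≡-Reasoning

two^-neg : ∀ k → two^ (ℤ.- (+ k)) ≡ half^ k
two^-neg zero = refl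
two^-neg (suc k) = refl

two^k*half^k : ∀ k → ι (+ (2 ℕ.^ k)) ℚ.* half^ k ≡ 1ℚ
two^k*half^k k = begin
  ι (+ (2 ℕ.^ k)) ℚ.* half^ k          ≡⟨ cong (ι (+ (2 ℕ.^ k)) ℚ.*_) (sym (two^-neg k)) ⟩
  ι (+ (2 ℕ.^ k)) ℚ.* two^ (ℤ.- (+ k)) ≡⟨ sym (two^-shift k (ℤ.- (+ k))) ⟩
  two^ (+ k ℤ.+ ℤ.- (+ k))             ≡⟨ cong two^ (ℤP.+-inverseʳ (+ k)) ⟩
  1ℚ                                   ∎
  where open ≡-Reasoning

two^-+ : ∀ x y → two^ (x ℤ.+ y) ≡ two^ x ℚ.* two^ y
two^-+ x (+ d) = trans (cong two^ (ℤP.+-comm x (+ d)))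
  (trans (two^-shift d x) (ℚP.*-comm (ι (+ (2 ℕ.^ d))) (two^ x)))
two^-+ x -[1+ d ] = sym (begin
  two^ x ℚ.* half^ (suc d)                   ≡⟨ cong (λ t → two^ t ℚ.* half^ (suc d)) x≡sd+z ⟩
  two^ (+ suc d ℤ.+ z) ℚ.* half^ (suc d)     ≡⟨ cong (ℚ._* half^ (suc d)) (two^-shift (suc d) z) ⟩
  (P ℚ.* two^ z) ℚ.* half^ (suc d)           ≡⟨ solve 3 (λ p t h → (p :* t) :* h := t :* (p :* h)) refl P (two^ z) (half^ (suc d)) ⟩
  two^ z ℚ.* (P ℚ.* half^ (suc d))           ≡⟨ cong (two^ z ℚ.*_) (two^k*half^k (suc d)) ⟩
  two^ z ℚ.* 1ℚ                              ≡⟨ ℚP.*-identityʳ (two^ z) ⟩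
  two^ z                                     ∎)
  where
  open ≡-Reasoning
  z = x ℤ.+ -[1+ d ]
  P = ι (+ (2 ℕ.^ suc d))
  x≡sd+z : x ≡ + suc d ℤ.+ z
  x≡sd+z = ℤS.solve 2 (λ x w → x ℤS.:= w ℤS.:+ (x ℤS.:+ ℤS.:- w)) refl x (+ suc d)

ι*two^-shift : ∀ m d x → ι m ℚ.* two^ (+ d ℤ.+ x) ≡ ι (m ℤ.* + (2 ℕ.^ d)) ℚ.* two^ x
ι*two^-shift m d x = begin
  ι m ℚ.* two^ (+ d ℤ.+ x)                ≡⟨ cong (ι m ℚ.*_) (two^-shift d x) ⟩
  ι m ℚ.* (ι (+ (2 ℕ.^ d)) ℚ.* two^ x)    ≡⟨ sym (ℚP.*-assoc (ι m) (ι (+ (2 ℕ.^ d))) (two^ x)) ⟩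
  (ι m ℚ.* ι (+ (2 ℕ.^ d))) ℚ.* two^ x    ≡⟨ cong (ℚ._* two^ x) (ι-* m (+ (2 ℕ.^ d))) ⟩
  ι (m ℤ.* + (2 ℕ.^ d)) ℚ.* two^ x        ∎
  where open ≡-Reasoning

ι*two^-cancel : ∀ x y k → ι x ℚ.* two^ k ≡ ι y ℚ.* two^ k → x ≡ y
ι*two^-cancel x y k eq = ι-injective x y (begin
  ι x                                  ≡⟨ sym (unscale x) ⟩
  (ι x ℚ.* two^ k) ℚ.* two^ (ℤ.- k)    ≡⟨ cong (ℚ._* two^ (ℤ.- k)) eq ⟩
  (ι y ℚ.* two^ k) ℚ.* two^ (ℤ.- k)    ≡⟨ unscale y ⟩
  ι y                                  ∎)
  where
  open ≡-Reasoning
  unscale : ∀ w → (ι w ℚ.* two^ k) ℚ.* two^ (ℤ.- k) ≡ ι w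
  unscale w = begin
    (ι w ℚ.* two^ k) ℚ.* two^ (ℤ.- k)  ≡⟨ ℚP.*-assoc (ι w) (two^ k) (two^ (ℤ.- k)) ⟩
    ι w ℚ.* (two^ k ℚ.* two^ (ℤ.- k))  ≡⟨ cong (ι w ℚ.*_) (sym (two^-+ k (ℤ.- k))) ⟩
    ι w ℚ.* two^ (k ℤ.+ ℤ.- k)         ≡⟨ cong (λ t → ι w ℚ.* two^ t) (ℤP.+-inverseʳ k) ⟩
    ι w ℚ.* 1ℚ                         ≡⟨ ℚP.*-identityʳ (ι w) ⟩
    ι w                                ∎

infix 4 _∈ℤ·_
_∈ℤ·_ : ℚ → ℚ → Set
q ∈ℤ· α = Σ ℤ λ z → q ≡ ι z ℚ.* α

0∈ℤ· : ∀ α → 0ℚ ∈ℤ· α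
0∈ℤ· α = + 0 , sym (ℚP.*-zeroˡ α)

∈ℤ·-refl : ∀ α → α ∈ℤ· α
∈ℤ·-refl α = + 1 , sym (ℚP.*-identityˡ α)

∈ℤ·-+ : ∀ {α x y} → x ∈ℤ· α → y ∈ℤ· α → x ℚ.+ y ∈ℤ· α
∈ℤ·-+ {α} (z , x≡) (w , y≡) = z ℤ.+ w , trans (cong₂ ℚ._+_ x≡ y≡)
  (trans (sym (ℚP.*-distribʳ-+ α (ι z) (ι w))) (cong (ℚ._* α) (ι-+ z w)))

∈ℤ·-* : ∀ {α β x y} → x ∈ℤ· α → y ∈ℤ· β → x ℚ.* y ∈ℤ· α ℚ.* β
∈ℤ·-* {α} {β} (z , x≡) (w , y≡) = z ℤ.* w , trans (cong₂ ℚ._*_ x≡ y≡)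
  (trans (solve 4 (λ a b c d → (a :* b) :* (c :* d) := (a :* c) :* (b :* d)) refl (ι z) α (ι w) β)
         (cong (ℚ._* (α ℚ.* β)) (ι-* z w)))

≤⇒gap : ∀ {i j} → i ≤ j → j ≡ + ∣ i - j ∣ ℤ.+ i
≤⇒gap {i} {j} i≤j = sym (trans (cong (ℤ._+ i) (ℤP.∣-∣-≤ i≤j))
  (ℤS.solve 2 (λ i j → (j ℤS.:- i) ℤS.:+ i ℤS.:= j) refl i j))

ℕ-2-adic : ∀ N → Acc ℕ._<_ N → N ≢ 0 →
  Σ ℕ λ e → Σ ℕ λ k → ¬ (2 ℕD.∣ k) × N ≡ 2 ℕ.^ e ℕ.* k
ℕ-2-adic N (acc smaller) N≢0 with 2 ∣? N
... | no 2∤N = 0 , N , 2∤N , sym (ℕP.+-identityʳ N)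
... | yes (divides q N≡q*2) with ℕ-2-adic q (smaller q<N) q≢0
  where
  q≢0 : q ≢ 0
  q≢0 refl = N≢0 N≡q*2
  q<N : q ℕ.< N
  q<N = subst (q ℕ.<_) (sym (trans N≡q*2 (ℕP.*-comm q 2)))
    (ℕP.m<m+n q (ℕP.n≢0⇒n>0 (λ q≡0 → q≢0 (trans (sym (ℕP.+-identityʳ q)) q≡0))))
... | e , k , k-odd , q≡ = suc e , k , k-odd , (begin
  N                     ≡⟨ N≡q*2 ⟩
  q ℕ.* 2               ≡⟨ cong (ℕ._* 2) q≡ ⟩
  2 ℕ.^ e ℕ.* k ℕ.* 2   ≡⟨ ℕP.*-comm (2 ℕ.^ e ℕ.* k) 2 ⟩
  2 ℕ.* (2 ℕ.^ e ℕ.* k) ≡⟨ sym (ℕP.*-assoc 2 (2 ℕ.^ e) k) ⟩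
  2 ℕ.^ suc e ℕ.* k     ∎)
  where open ≡-Reasoning

ℤ-2-adic : ∀ z → z ≢ + 0 → Σ ℕ λ e → Σ ℤ λ m → Odd m × z ≡ m ℤ.* + (2 ℕ.^ e)
ℤ-2-adic (+ N) z≢0 with ℕ-2-adic N (<-wellFounded N) (λ N≡0 → z≢0 (cong +_ N≡0))
... | e , k , k-odd , N≡ = e , + k , k-odd ,
  trans (cong +_ (trans N≡ (ℕP.*-comm (2 ℕ.^ e) k))) (ℤP.pos-* k (2 ℕ.^ e))
ℤ-2-adic -[1+ N ] _ with ℕ-2-adic (suc N) (<-wellFounded (suc N)) (λ ())
... | e , k , k-odd , N≡ = e , ℤ.- (+ k) , (λ 2∣-k → k-odd (subst (2 ℕD.∣_) (ℤP.∣-i∣≡∣i∣ (+ k)) 2∣-k)) ,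
  trans (cong (λ t → ℤ.- (+ t)) (trans N≡ (ℕP.*-comm (2 ℕ.^ e) k)))
        (trans (cong ℤ.-_ (ℤP.pos-* k (2 ℕ.^ e))) (ℤP.neg-distribˡ-* (+ k) (+ (2 ℕ.^ e))))

gran⇒∈ℤ· : ∀ {q k d} → Gran q k → k ≤ d → q ∈ℤ· two^ (ℤ.- d)
gran⇒∈ℤ· {q} {k} {d} (m , _ , q≡) k≤d = m ℤ.* + (2 ℕ.^ g) , (begin
  q                                           ≡⟨ q≡ ⟩
  ι m ℚ.* two^ (ℤ.- k)                        ≡⟨ cong (λ t → ι m ℚ.* two^ t) (≤⇒gap (ℤP.neg-mono-≤ k≤d)) ⟩
  ι m ℚ.* two^ (+ g ℤ.+ ℤ.- d)                ≡⟨ ι*two^-shift m g (ℤ.- d) ⟩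
  ι (m ℤ.* + (2 ℕ.^ g)) ℚ.* two^ (ℤ.- d)      ∎)
  where
  open ≡-Reasoning
  g = ∣ ℤ.- d - ℤ.- k ∣

-- Conversely, a rational of granularity c in 2^{-d}ℤ has c ≤ d: otherwise its odd
-- numerator would be a multiple of 2^{c-d}.
∈ℤ·⇒gran≤ : ∀ {q c d} → Gran q c → q ∈ℤ· two^ (ℤ.- d) → c ≤ d
∈ℤ·⇒gran≤ {q} {c} {d} (m , m-odd , q≡m) (z , q≡z) with c ℤP.≤? d
... | yes c≤d = c≤d
... | no c≰d = ⊥-elim (m-odd (subst (2 ℕD.∣_) (sym ∣m∣≡) 2∣∣z∣*2^g))
  where
  open ≡-Reasoning
  g = ∣ ℤ.- c - ℤ.- ℤ.suc d ∣
  -d≡ : ℤ.- d ≡ + suc g ℤ.+ ℤ.- c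
  -d≡ = begin
    ℤ.- d                          ≡⟨ ℤS.solve 1 (λ d → ℤS.:- d ℤS.:= ℤS.con (+ 1) ℤS.:+ ℤS.:- (ℤS.con (+ 1) ℤS.:+ d)) refl d ⟩
    + 1 ℤ.+ ℤ.- ℤ.suc d            ≡⟨ cong (λ t → + 1 ℤ.+ t) (≤⇒gap (ℤP.neg-mono-≤ (ℤP.i<j⇒suc[i]≤j (ℤP.≰⇒> c≰d)))) ⟩
    + 1 ℤ.+ (+ g ℤ.+ ℤ.- c)        ≡⟨ sym (ℤP.+-assoc (+ 1) (+ g) (ℤ.- c)) ⟩
    + suc g ℤ.+ ℤ.- c              ∎
  m≡ : m ≡ z ℤ.* + (2 ℕ.^ suc g)
  m≡ = ι*two^-cancel m (z ℤ.* + (2 ℕ.^ suc g)) (ℤ.- c) (begin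
    ι m ℚ.* two^ (ℤ.- c)                                   ≡⟨ sym q≡m ⟩
    q                                                      ≡⟨ q≡z ⟩
    ι z ℚ.* two^ (ℤ.- d)                                   ≡⟨ cong (λ t → ι z ℚ.* two^ t) -d≡ ⟩
    ι z ℚ.* two^ (+ suc g ℤ.+ ℤ.- c)                       ≡⟨ ι*two^-shift z (suc g) (ℤ.- c) ⟩
    ι (z ℤ.* + (2 ℕ.^ suc g)) ℚ.* two^ (ℤ.- c)             ∎)
  ∣m∣≡ : ∣ m ∣ ≡ ∣ z ∣ ℕ.* 2 ℕ.^ suc g
  ∣m∣≡ = trans (cong ∣_∣ m≡) (ℤP.abs-* z (+ (2 ℕ.^ suc g)))
  2∣∣z∣*2^g : 2 ℕD.∣ ∣ z ∣ ℕ.* 2 ℕ.^ suc g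
  2∣∣z∣*2^g = ℕD.∣n⇒∣m*n ∣ z ∣ (ℕD.m∣m*n (2 ℕ.^ g))

dyadic⇒gran : ∀ n {q} → q ∈ℤ· half^ n → q ≢ 0ℚ → Σ ℤ (Gran q)
dyadic⇒gran n {q} (z , q≡) q≢0 with z ℤP.≟ + 0
... | yes refl = ⊥-elim (q≢0 (trans q≡ (ℚP.*-zeroˡ (half^ n))))
... | no z≢0 with ℤ-2-adic z z≢0
... | e , m , m-odd , z≡ = ℤ.- k , m , m-odd , (begin
    q                                               ≡⟨ q≡ ⟩
    ι z ℚ.* half^ n                                 ≡⟨ cong₂ (λ a b → ι a ℚ.* b) z≡ (sym (two^-neg n)) ⟩
    ι (m ℤ.* + (2 ℕ.^ e)) ℚ.* two^ (ℤ.- (+ n))      ≡⟨ sym (ι*two^-shift m e (ℤ.- (+ n))) ⟩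
    ι m ℚ.* two^ k                                  ≡⟨ cong (λ t → ι m ℚ.* two^ t) (sym (ℤP.neg-involutive k)) ⟩
    ι m ℚ.* two^ (ℤ.- (ℤ.- k))                      ∎)
  where
  open ≡-Reasoning
  k = + e ℤ.+ ℤ.- (+ n)

sum-++ : ∀ xs ys → sumℚ (xs ++ ys) ≡ sumℚ xs ℚ.+ sumℚ ys
sum-++ [] ys = sym (ℚP.+-identityˡ (sumℚ ys))
sum-++ (x ∷ xs) ys = trans (cong (x ℚ.+_) (sum-++ xs ys)) (sym (ℚP.+-assoc x (sumℚ xs) (sumℚ ys)))

module _ {A : Set} where

  sum-cong : ∀ {f g : A → ℚ} → (∀ x → f x ≡ g x) → ∀ L → sumℚ (map f L) ≡ sumℚ (map g L)
  sum-cong f≡g [] = refl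
  sum-cong f≡g (x ∷ L) = cong₂ ℚ._+_ (f≡g x) (sum-cong f≡g L)

  sum-+ : ∀ (f g : A → ℚ) L → sumℚ (map (λ x → f x ℚ.+ g x) L) ≡ sumℚ (map f L) ℚ.+ sumℚ (map g L)
  sum-+ f g [] = refl
  sum-+ f g (x ∷ L) = trans (cong ((f x ℚ.+ g x) ℚ.+_) (sum-+ f g L))
    (solve 4 (λ a b c d → (a :+ b) :+ (c :+ d) := (a :+ c) :+ (b :+ d)) refl
      (f x) (g x) (sumℚ (map f L)) (sumℚ (map g L)))

  sum-scale : ∀ k (f : A → ℚ) L → sumℚ (map (λ x → k ℚ.* f x) L) ≡ k ℚ.* sumℚ (map f L)
  sum-scale k f [] = sym (ℚP.*-zeroʳ k)
  sum-scale k f (x ∷ L) = trans (cong (k ℚ.* f x ℚ.+_) (sum-scale k f L))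
    (sym (ℚP.*-distribˡ-+ k (f x) (sumℚ (map f L))))

  sum-∈ℤ· : ∀ {α} (f : A → ℚ) → (∀ x → f x ∈ℤ· α) → ∀ L → sumℚ (map f L) ∈ℤ· α
  sum-∈ℤ· {α} f f∈ [] = 0∈ℤ· α
  sum-∈ℤ· f f∈ (x ∷ L) = ∈ℤ·-+ (f∈ x) (sum-∈ℤ· f f∈ L)

sum-cube : ∀ n (G : Cube (suc n) → ℚ) →
  sumℚ (map G (allPoints (suc n))) ≡ sumℚ (map (λ x → G (false ∷ x) ℚ.+ G (true ∷ x)) (allPoints n))
sum-cube n G = begin
  sumℚ (map G (map (false ∷_) P ++ map (true ∷_) P))
    ≡⟨ cong sumℚ (LP.map-++ G (map (false ∷_) P) (map (true ∷_) P)) ⟩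
  sumℚ (map G (map (false ∷_) P) ++ map G (map (true ∷_) P))
    ≡⟨ sum-++ (map G (map (false ∷_) P)) (map G (map (true ∷_) P)) ⟩
  sumℚ (map G (map (false ∷_) P)) ℚ.+ sumℚ (map G (map (true ∷_) P))
    ≡⟨ cong₂ (λ l r → sumℚ l ℚ.+ sumℚ r) (sym (LP.map-∘ P)) (sym (LP.map-∘ P)) ⟩
  sumℚ (map (λ x → G (false ∷ x)) P) ℚ.+ sumℚ (map (λ x → G (true ∷ x)) P)
    ≡⟨ sym (sum-+ (λ x → G (false ∷ x)) (λ x → G (true ∷ x)) P) ⟩
  sumℚ (map (λ x → G (false ∷ x) ℚ.+ G (true ∷ x)) P) ∎
  where
  open ≡-Reasoning
  P = allPoints n

sign-xor : ∀ p q → sign (p xor q) ≡ sign p ℚ.* sign q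
sign-xor true true = refl
sign-xor true false = refl
sign-xor false true = refl
sign-xor false false = refl

fourier-cong : ∀ {n} {u w : Cube n → ℚ} → (∀ x → u x ≡ w x) → ∀ S → fourier u S ≡ fourier w S
fourier-cong {n} u≡w S = cong (half^ n ℚ.*_)
  (sum-cong (λ x → cong (ℚ._* sign (parity S x)) (u≡w x)) (allPoints n))

fourier-+ : ∀ {n} (u w : Cube n → ℚ) S →
  fourier (λ x → u x ℚ.+ w x) S ≡ fourier u S ℚ.+ fourier w S
fourier-+ {n} u w S = begin
  half^ n ℚ.* sumℚ (map (λ x → (u x ℚ.+ w x) ℚ.* χ x) P)
    ≡⟨ cong (half^ n ℚ.*_) (sum-cong (λ x → ℚP.*-distribʳ-+ (χ x) (u x) (w x)) P) ⟩
  half^ n ℚ.* sumℚ (map (λ x → u x ℚ.* χ x ℚ.+ w x ℚ.* χ x) P)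
    ≡⟨ cong (half^ n ℚ.*_) (sum-+ (λ x → u x ℚ.* χ x) (λ x → w x ℚ.* χ x) P) ⟩
  half^ n ℚ.* (sumℚ (map (λ x → u x ℚ.* χ x) P) ℚ.+ sumℚ (map (λ x → w x ℚ.* χ x) P))
    ≡⟨ ℚP.*-distribˡ-+ (half^ n) _ _ ⟩
  fourier u S ℚ.+ fourier w S ∎
  where
  open ≡-Reasoning
  P = allPoints n
  χ = λ x → sign (parity S x)

-- The Fourier coefficients of u at b ∷ S are those of  split b u : x ↦ ½ (u(0x) + (-1)^b u(1x))
-- at S; this is what makes induction on the dimension possible.
split : ∀ {n} → Bool → (Cube (suc n) → ℚ) → Cube n → ℚ
split b u x = ½ ℚ.* (u (false ∷ x) ℚ.+ sign b ℚ.* u (true ∷ x))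

fourier-∷ : ∀ {n} (u : Cube (suc n) → ℚ) b S → fourier u (b ∷ S) ≡ fourier (split b u) S
fourier-∷ {n} u b S = begin
  (½ ℚ.* half^ n) ℚ.* sumℚ (map G (allPoints (suc n)))
    ≡⟨ cong ((½ ℚ.* half^ n) ℚ.*_) (trans (sum-cube n G) (sum-cong halves P)) ⟩
  (½ ℚ.* half^ n) ℚ.* sumℚ (map H P)
    ≡⟨ solve 3 (λ h k s → (h :* k) :* s := k :* (h :* s)) refl ½ (half^ n) (sumℚ (map H P)) ⟩
  half^ n ℚ.* (½ ℚ.* sumℚ (map H P))
    ≡⟨ cong (half^ n ℚ.*_) (sym (sum-scale ½ H P)) ⟩
  half^ n ℚ.* sumℚ (map (λ x → ½ ℚ.* H x) P)
    ≡⟨ cong (half^ n ℚ.*_) (sum-cong (λ x → solve 5 (λ h u₀ s u₁ χ → h :* ((u₀ :* χ) :+ s :* (u₁ :* χ))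
          := (h :* (u₀ :+ s :* u₁)) :* χ) refl ½ (u (false ∷ x)) (sign b) (u (true ∷ x)) (χ x)) P) ⟩
  fourier (split b u) S ∎
  where
  open ≡-Reasoning
  P = allPoints n
  χ = λ (x : Cube n) → sign (parity S x)
  G = λ (y : Cube (suc n)) → u y ℚ.* sign (parity (b ∷ S) y)
  H = λ (x : Cube n) → u (false ∷ x) ℚ.* χ x ℚ.+ sign b ℚ.* (u (true ∷ x) ℚ.* χ x)
  halves : ∀ x → G (false ∷ x) ℚ.+ G (true ∷ x) ≡ H x
  halves x = cong₂ ℚ._+_
    (cong (λ t → u (false ∷ x) ℚ.* sign (t xor parity S x)) (∧-zeroʳ b))
    (begin
      u (true ∷ x) ℚ.* sign ((b ∧ true) xor parity S x) ≡⟨ cong (λ t → u (true ∷ x) ℚ.* sign (t xor parity S x)) (∧-identityʳ b) ⟩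
      u (true ∷ x) ℚ.* sign (b xor parity S x)          ≡⟨ cong (u (true ∷ x) ℚ.*_) (sign-xor b (parity S x)) ⟩
      u (true ∷ x) ℚ.* (sign b ℚ.* χ x)                 ≡⟨ solve 3 (λ a s c → a :* (s :* c) := s :* (a :* c)) refl (u (true ∷ x)) (sign b) (χ x) ⟩
      sign b ℚ.* (u (true ∷ x) ℚ.* χ x)                 ∎)

split-* : ∀ {n} (u v : Cube (suc n) → ℚ) b x →
  split b (λ y → u y ℚ.* v y) x ≡
  split false u x ℚ.* split b v x ℚ.+ split true u x ℚ.* split (not b) v x
split-* u v false x = solve 4 (λ u₀ u₁ v₀ v₁ →
    con ½ :* (u₀ :* v₀ :+ con 1ℚ :* (u₁ :* v₁))
    := (con ½ :* (u₀ :+ con 1ℚ :* u₁)) :* (con ½ :* (v₀ :+ con 1ℚ :* v₁))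
       :+ (con ½ :* (u₀ :+ con (ℚ.- 1ℚ) :* u₁)) :* (con ½ :* (v₀ :+ con (ℚ.- 1ℚ) :* v₁)))
  refl (u (false ∷ x)) (u (true ∷ x)) (v (false ∷ x)) (v (true ∷ x))
split-* u v true x = solve 4 (λ u₀ u₁ v₀ v₁ →
    con ½ :* (u₀ :* v₀ :+ con (ℚ.- 1ℚ) :* (u₁ :* v₁))
    := (con ½ :* (u₀ :+ con 1ℚ :* u₁)) :* (con ½ :* (v₀ :+ con (ℚ.- 1ℚ) :* v₁))
       :+ (con ½ :* (u₀ :+ con (ℚ.- 1ℚ) :* u₁)) :* (con ½ :* (v₀ :+ con 1ℚ :* v₁)))
  refl (u (false ∷ x)) (u (true ∷ x)) (v (false ∷ x)) (v (true ∷ x))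

fourier-* : ∀ n {α β} (u v : Cube n → ℚ) →
  (∀ S → fourier u S ∈ℤ· α) → (∀ S → fourier v S ∈ℤ· β) →
  ∀ S → fourier (λ x → u x ℚ.* v x) S ∈ℤ· α ℚ.* β
fourier-* zero u v û∈ v̂∈ [] = subst (_∈ℤ· _) (sym (fourier0 (λ x → u x ℚ.* v x)))
  (∈ℤ·-* (subst (_∈ℤ· _) (fourier0 u) (û∈ [])) (subst (_∈ℤ· _) (fourier0 v) (v̂∈ [])))
  where
  fourier0 : (w : Cube 0 → ℚ) → fourier w [] ≡ w []
  fourier0 w = solve 1 (λ a → con 1ℚ :* (a :* con 1ℚ :+ con 0ℚ) := a) refl (w [])
fourier-* (suc n) u v û∈ v̂∈ (b ∷ S) = subst (_∈ℤ· _) (sym uv̂≡)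
  (∈ℤ·-+ (fourier-* n (split false u) (split b v) (split∈ u û∈ false) (split∈ v v̂∈ b) S)
         (fourier-* n (split true u) (split (not b) v) (split∈ u û∈ true) (split∈ v v̂∈ (not b)) S))
  where
  split∈ : ∀ {γ} (w : Cube (suc n) → ℚ) → (∀ S → fourier w S ∈ℤ· γ) → ∀ c T → fourier (split c w) T ∈ℤ· γ
  split∈ w ŵ∈ c T = subst (_∈ℤ· _) (fourier-∷ w c T) (ŵ∈ (c ∷ T))
  uv̂≡ : fourier (λ x → u x ℚ.* v x) (b ∷ S) ≡
        fourier (λ x → split false u x ℚ.* split b v x) S ℚ.+ fourier (λ x → split true u x ℚ.* split (not b) v x) S
  uv̂≡ = trans (fourier-∷ (λ x → u x ℚ.* v x) b S)
         (trans (fourier-cong (split-* u v b) S)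
           (fourier-+ (λ x → split false u x ℚ.* split b v x) (λ x → split true u x ℚ.* split (not b) v x) S))

IntegerValued : ∀ {n} → (Cube n → ℚ) → Set
IntegerValued u = ∀ x → u x ∈ℤ· 1ℚ

sign-integer : ∀ b → sign b ∈ℤ· 1ℚ
sign-integer false = + 1 , refl
sign-integer true = -[1+ 0 ] , refl

fourier-integer : ∀ {n} (u : Cube n → ℚ) → IntegerValued u → ∀ S → fourier u S ∈ℤ· half^ n
fourier-integer {n} u u∈ S = subst (fourier u S ∈ℤ·_) (ℚP.*-identityʳ (half^ n))
  (∈ℤ·-* (∈ℤ·-refl (half^ n))
    (sum-∈ℤ· (λ x → u x ℚ.* sign (parity S x)) (λ x → ∈ℤ·-* (u∈ x) (sign-integer (parity S x))) (allPoints n)))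

dyadic⇒∈ℤ· : ∀ n {q a} → q ∈ℤ· half^ n → (∀ k → q ≢ 0ℚ → Gran q k → k ≤ a) → q ∈ℤ· two^ (ℤ.- a)
dyadic⇒∈ℤ· n {q} q∈ gran≤a with q ℚP.≟ 0ℚ
... | yes refl = 0∈ℤ· _
... | no q≢0 with dyadic⇒gran n q∈ q≢0
... | k , gran-k = gran⇒∈ℤ· gran-k (gran≤a k q≢0 gran-k)

fourierGran⇒∈ℤ· : ∀ {n} (u : Cube n → ℚ) {a} → IntegerValued u → FourierGran u a →
  ∀ S → fourier u S ∈ℤ· two^ (ℤ.- a)
fourierGran⇒∈ℤ· {n} u u∈ (_ , maximal) S = dyadic⇒∈ℤ· n (fourier-integer u u∈ S) (λ k → maximal S k)

-- gran(uv) ≤ gran(u) + gran(v) for integer-valued u and v: the coefficient of uv that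
-- realises its granularity c lies in 2^{-a}2^{-b}ℤ = 2^{-(a+b)}ℤ.
gran-* : ∀ {n} (u v w : Cube n → ℚ) {a b c} → IntegerValued u → IntegerValued v →
  (∀ x → w x ≡ u x ℚ.* v x) → FourierGran u a → FourierGran v b → FourierGran w c → c ≤ a + b
gran-* {n} u v w {a} {b} u∈ v∈ w≡uv Ga Gb ((S , _ , gran-c) , _) = ∈ℤ·⇒gran≤ gran-c ŵ∈
  where
  scale≡ : two^ (ℤ.- a) ℚ.* two^ (ℤ.- b) ≡ two^ (ℤ.- (a + b))
  scale≡ = trans (sym (two^-+ (ℤ.- a) (ℤ.- b))) (cong two^ (sym (ℤP.neg-distrib-+ a b)))
  ŵ∈ : fourier w S ∈ℤ· two^ (ℤ.- (a + b))
  ŵ∈ = subst₂ _∈ℤ·_ (sym (fourier-cong w≡uv S)) scale≡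
    (fourier-* n u v (fourierGran⇒∈ℤ· u u∈ Ga) (fourierGran⇒∈ℤ· v v∈ Gb) S)

pm-integer : ∀ {n} (f : Cube n → Bool) → IntegerValued (pm f)
pm-integer f x = sign-integer (f x)

sign-xor-cancel : ∀ p q → sign p ≡ sign (p xor q) ℚ.* sign q
sign-xor-cancel p q = trans (cong sign (sym p⊕q⊕q≡p)) (sign-xor (p xor q) q)
  where
  p⊕q⊕q≡p : (p xor q) xor q ≡ p
  p⊕q⊕q≡p = trans (xor-assoc p q q) (trans (cong (p xor_) (xor-same q)) (xor-identityʳ p))

≤+⇒-≤ : ∀ {x y c} → x ≤ c + y → x - y ≤ c
≤+⇒-≤ {x} {y} {c} x≤c+y = subst (x - y ≤_) (ℤS.solve 2 (λ c y → (c ℤS.:+ y) ℤS.:- y ℤS.:= c) refl c y)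
  (ℤP.+-monoˡ-≤ (ℤ.- y) x≤c+y)

∣-∣≤ : ∀ {a b c} → a ≤ c + b → b ≤ c + a → + ∣ a - b ∣ ≤ c
∣-∣≤ {a} {b} {c} a≤c+b b≤c+a with ℤP.≤-total a b
... | inj₁ a≤b = subst (_≤ c) (sym (ℤP.∣-∣-≤ a≤b)) (≤+⇒-≤ b≤c+a)
... | inj₂ b≤a = subst (_≤ c) (sym (trans (cong +_ (ℤP.∣i-j∣≡∣j-i∣ a b)) (ℤP.∣-∣-≤ b≤a))) (≤+⇒-≤ a≤c+b)

fact2p2 : (n : ℕ) (f g : Cube n → Bool) (a b c : ℤ) →
    FourierGran (pm f) a →
    FourierGran (pm g) b →
    FourierGran (pm (λ x → f x xor g x)) c →
    (+ ∣ a - b ∣ ≤ c) × (c ≤ a + b)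
fact2p2 n f g a b c Gf Gg Gh = ∣-∣≤ a≤c+b b≤c+a , c≤a+b
  where
  h : Cube n → Bool
  h x = f x xor g x
  c≤a+b : c ≤ a + b
  c≤a+b = gran-* (pm f) (pm g) (pm h) (pm-integer f) (pm-integer g) (λ x → sign-xor (f x) (g x)) Gf Gg Gh
  a≤c+b : a ≤ c + b
  a≤c+b = gran-* (pm h) (pm g) (pm f) (pm-integer h) (pm-integer g) (λ x → sign-xor-cancel (f x) (g x)) Gh Gg Gf
  b≤c+a : b ≤ c + a
  b≤c+a = gran-* (pm h) (pm f) (pm g) (pm-integer h) (pm-integer f)
    (λ x → trans (sign-xor-cancel (g x) (f x)) (cong (λ t → sign t ℚ.* sign (f x)) (xor-comm (g x) (f x)))) Gh Gf Gg
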